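{- For integers $k\ge2$ and $1\le r\le n$, $$T(n,k,r)=\sum_{\substack{\lambda\vdash n\\ l(\lambda)=r}}f_\lambda\prod_{i=1}^{r}\Big(\sum_{r'=1}^{\lambda_i}T(\lambda_i,k-1,r')\Big).$$
   Context: $S(a,b)$ are the Stirling numbers of the second kind and $T(n,k,r)=\sum\prod_{j=1}^{k}S(i_{j-1},i_j)$ over integer tuples $n\ge i_1\ge\dots\ge i_{k-1}\ge r$ with $i_0=n$, $i_k=r$. For a partition $\lambda=(\lambda_1\ge\dots\ge\lambda_l>0)$ of $n$ with length $l(\lambda)$ and $m_j$ parts equal to $j$, $f_\lambda=\frac{n!}{\prod_j(j!)^{m_j}m_j!}$. -}

module Defs where

open import Data.Nat.Base using (ℕ; zero; suc; _+_; _*_; _∸_; _^_; _≥_; _!; NonZero; _/_)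
open import Data.Nat.Properties using (_≟_; _≥?_; m*n≢0; m^n≢0; _!≢0)
open import Data.List.Base using (List; []; _∷_; _++_; [_]; map; filter; length; concatMap; applyUpTo)
open import Data.Nat.ListAction using (sum; product)
open import Data.List.Relation.Unary.Linked using (Linked; linked?)
open import Data.Product using (_×_)
open import Relation.Nullary.Decidable using (_×-dec_)
open import Relation.Binary.PropositionalEquality using (_≡_)

S : ℕ → ℕ → ℕ
S zero    zero    = 1
S zero    (suc b) = 0
S (suc a) zero    = 0
S (suc a) (suc b) = suc b * S a (suc b) + S a b

range : ℕ → ℕ → List ℕ
range a b = applyUpTo (a +_) (suc b ∸ a)

tuples : ℕ → ℕ → ℕ → List (List ℕ)
tuples zero      lo hi = [] ∷ []
tuples (suc len) lo hi = concatMap (λ i → map (i ∷_) (tuples len lo hi)) (range lo hi)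

NonIncreasing : List ℕ → Set
NonIncreasing = Linked _≥_

chainProd : List ℕ → ℕ
chainProd []            = 1
chainProd (x ∷ [])      = 1
chainProd (x ∷ y ∷ xs)  = S x y * chainProd (y ∷ xs)

-- T(n,k,r) = Σ over n ≥ i_1 ≥ … ≥ i_{k-1} ≥ r of ∏_{j=1}^k S(i_{j-1}, i_j), i_0 = n, i_k = r
-- (the tuples (i_1,…,i_{k-1}) are enumerated among all tuples with entries in [r,n]
--  and filtered by n ≥ i_1 ≥ … ≥ i_{k-1} ≥ r)
T : ℕ → ℕ → ℕ → ℕ
T n k r =
  sum (map (λ is → chainProd (n ∷ is ++ [ r ]))
           (filter (λ is → linked? _≥?_ (n ∷ is ++ [ r ])) (tuples (k ∸ 1) r n)))

-- partitions λ of n with l(λ) = r, as weakly decreasing lists of length r of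
-- positive integers (entries enumerated in [1,n]) summing to n
partitionsOfLength : ℕ → ℕ → List (List ℕ)
partitionsOfLength n r =
  filter (λ lam → linked? _≥?_ lam ×-dec (sum lam ≟ n)) (tuples r 1 n)

mult : ℕ → List ℕ → ℕ
mult j lam = length (filter (j ≟_) lam)

denom : ℕ → List ℕ → ℕ
denom zero    lam = 1
denom (suc j) lam = denom j lam * ((((suc j) !) ^ mult (suc j) lam) * (mult (suc j) lam) !)

denom-nz : ∀ j lam → NonZero (denom j lam)
denom-nz zero    lam = _
denom-nz (suc j) lam =
  m*n≢0 (denom j lam) _ {{denom-nz j lam}}
    {{m*n≢0 _ _ {{m^n≢0 _ (mult (suc j) lam) {{(suc j) !≢0}}}} {{(mult (suc j) lam) !≢0}}}}

-- f_λ = n! / ∏_j (j!)^{m_j} m_j!   (parts of a partition of n are ≤ n)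
f : ℕ → List ℕ → ℕ
f n lam = (n ! / denom n lam) {{denom-nz n lam}}

innerProd : ℕ → List ℕ → ℕ
innerProd k lam = product (map (λ p → sum (map (T p (k ∸ 1)) (range 1 p))) lam)

rhs : ℕ → ℕ → ℕ → ℕ
rhs n k r = sum (map (λ lam → f n lam * innerProd k lam) (partitionsOfLength n r))

{-# OPTIONS --safe #-}
-- Read a sequence a as the exponential generating function A(z) = Σ aₙ zⁿ/n!.  The partial Bell
-- polynomial B_{n,r}(a) is n! [zⁿ] A(z)ʳ/r!, so S(n,r) = B_{n,r}(1,1,…), and Faà di Bruno's formula
-- Σᵢ B_{n,i}(a) B_{i,r}(c) = B_{n,r}(C ∘ A) collapses the iterated sum T(n,k,r) into B_{n,r}(x) with
-- x_p = Σ_{r'} T(p,k−1,r').  The theorem is then the expansion of B_{n,r}(x) over partitions λ of n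
-- with r parts, proved by induction on the largest allowed part K.  Splitting off the t parts equal
-- to K multiplies f_λ by C(n, tK) times the number of ways to cut tK points into t blocks of size K,
-- which is exactly the coefficient the binomial theorem gives for (A_{<K}(z) + x_K zᴷ/K!)ʳ/r!.
module Submission where

open import Defs
open import Data.Nat.Base
open import Data.Nat.Properties
open import Data.Nat.Combinatorics
  using (_C_; nCk≡n!/k![n-k]!; k>n⇒nCk≡0; nCk≡nC[n∸k]; nC1≡n; nCk+nC[k+1]≡[n+1]C[k+1]; k![n∸k]!∣n!)
open import Data.Nat.DivMod using (/-congˡ; m*n/n≡m; m/n*n≡m)
open import Data.Nat.Tactic.RingSolver using (solve-∀)
open import Algebra.Properties.CommutativeSemigroup +-commutativeSemigroup
  using () renaming (interchange to +-interchange)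
open import Algebra.Properties.CommutativeSemigroup *-commutativeSemigroup using (x∙yz≈y∙xz)
open import Data.Product using (_×_; _,_; proj₂)
open import Data.List.Base using (List; []; _∷_; _++_; [_]; map; filter; length; concatMap; applyUpTo; replicate)
open import Data.List.Properties
  using (map-cong; map-cong-local; map-∘; map-++; filter-++; filter-accept; filter-reject; length-++)
open import Data.List.Relation.Unary.All as All using (All; []; _∷_)
open import Data.List.Relation.Unary.All.Properties using (replicate⁺; map⁺; concat⁺; applyUpTo⁺₁)
open import Data.List.Relation.Unary.Linked as Linked using (linked?; []; [-]; _∷_)
open import Data.Nat.ListAction using (sum; product)
open import Data.Nat.ListAction.Properties using (sum-++; product-++)
open import Relation.Unary using (Decidable)
open import Data.Empty using (⊥-elim)
open import Data.Sum using (_⊎_; inj₁; inj₂)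
open import Function.Base using (_∘_)
open import Relation.Nullary using (Dec; yes; no; ¬_; _×-dec_)
open import Relation.Binary.PropositionalEquality hiding ([_])
open ≡-Reasoning

Seq : Set
Seq = ℕ → ℕ

Σ< : ℕ → Seq → ℕ
Σ< zero    f = 0
Σ< (suc n) f = Σ< n f + f n

Σ<-cong : ∀ n {f g : Seq} → (∀ i → i < n → f i ≡ g i) → Σ< n f ≡ Σ< n g
Σ<-cong zero    h = refl
Σ<-cong (suc n) h = cong₂ _+_ (Σ<-cong n (λ i i<n → h i (m<n⇒m<1+n i<n))) (h n ≤-refl)

Σ<-zero : ∀ n (f : Seq) → (∀ i → i < n → f i ≡ 0) → Σ< n f ≡ 0
Σ<-zero zero    f h = refl
Σ<-zero (suc n) f h = cong₂ _+_ (Σ<-zero n f (λ i i<n → h i (m<n⇒m<1+n i<n))) (h n ≤-refl)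

Σ<-head : ∀ n (f : Seq) → Σ< (suc n) f ≡ f 0 + Σ< n (f ∘ suc)
Σ<-head zero    f = +-comm 0 (f 0)
Σ<-head (suc n) f = trans (cong (_+ f (suc n)) (Σ<-head n f)) (+-assoc (f 0) _ _)

Σ<-+ : ∀ n (f g : Seq) → Σ< n (λ i → f i + g i) ≡ Σ< n f + Σ< n g
Σ<-+ zero    f g = refl
Σ<-+ (suc n) f g =
  trans (cong (_+ (f n + g n)) (Σ<-+ n f g)) (+-interchange (Σ< n f) (Σ< n g) (f n) (g n))

Σ<-*ˡ : ∀ n c (f : Seq) → c * Σ< n f ≡ Σ< n (λ i → c * f i)
Σ<-*ˡ zero    c f = *-zeroʳ c
Σ<-*ˡ (suc n) c f = trans (*-distribˡ-+ c (Σ< n f) (f n)) (cong (_+ c * f n) (Σ<-*ˡ n c f))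

Σ<-swap : ∀ n m (f : ℕ → ℕ → ℕ) → Σ< n (λ i → Σ< m (f i)) ≡ Σ< m (λ j → Σ< n (λ i → f i j))
Σ<-swap zero    m f = sym (Σ<-zero m _ (λ _ _ → refl))
Σ<-swap (suc n) m f =
  trans (cong (_+ Σ< m (f n)) (Σ<-swap n m f)) (sym (Σ<-+ m _ (f n)))

Σ<-shift : ∀ m k (f : Seq) → Σ< m f + Σ< k (λ j → f (m + j)) ≡ Σ< (m + k) f
Σ<-shift m zero    f = trans (+-identityʳ _) (cong (λ z → Σ< z f) (sym (+-identityʳ m)))
Σ<-shift m (suc k) f = begin
  Σ< m f + (Σ< k (λ j → f (m + j)) + f (m + k)) ≡⟨ +-assoc (Σ< m f) _ _ ⟨
  Σ< m f + Σ< k (λ j → f (m + j)) + f (m + k)   ≡⟨ cong (_+ f (m + k)) (Σ<-shift m k f) ⟩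
  Σ< (suc (m + k)) f                            ≡⟨ cong (λ z → Σ< z f) (+-suc m k) ⟨
  Σ< (m + suc k) f                              ∎

Σ<-extend : ∀ {m n} (f : Seq) → m ≤ n → (∀ i → m ≤ i → f i ≡ 0) → Σ< n f ≡ Σ< m f
Σ<-extend {m} f m≤n tail-zero with m≤n⇒∃[o]m+o≡n m≤n
... | k , refl = begin
  Σ< (m + k) f                    ≡⟨ Σ<-shift m k f ⟨
  Σ< m f + Σ< k (λ j → f (m + j)) ≡⟨ cong (Σ< m f +_) (Σ<-zero k _ (λ j _ → tail-zero (m + j) (m≤m+n m j))) ⟩
  Σ< m f + 0                      ≡⟨ +-identityʳ _ ⟩
  Σ< m f                          ∎

Σ<-single : ∀ n k (f : Seq) → k < n → (∀ i → i ≢ k → f i ≡ 0) → Σ< n f ≡ f k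
Σ<-single (suc n) k f k<1+n others-zero with k ≟ n
... | yes refl = cong (_+ f k) (Σ<-zero k f (λ i i<k → others-zero i (<⇒≢ i<k)))
... | no k≢n   = trans (cong₂ _+_ (Σ<-single n k f (≤∧≢⇒< (≤-pred k<1+n) k≢n) others-zero)
                                  (others-zero n (k≢n ∘ sym)))
                       (+-identityʳ _)

-- Exponential generating functions

-- Reading f as Σ fₙ xⁿ/n!, D is the derivative and ⊛ the product, defined by the Leibniz rule.
D : Seq → Seq
D f n = f (suc n)

infixl 7 _⊛_

_⊛_ : Seq → Seq → Seq
(f ⊛ g) zero    = f 0 * g 0
(f ⊛ g) (suc n) = (D f ⊛ g) n + (f ⊛ D g) n

⊛-cong : ∀ n {f f′ g g′ : Seq} → (∀ i → i ≤ n → f i ≡ f′ i) → (∀ i → i ≤ n → g i ≡ g′ i) →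
         (f ⊛ g) n ≡ (f′ ⊛ g′) n
⊛-cong zero    hf hg = cong₂ _*_ (hf 0 z≤n) (hg 0 z≤n)
⊛-cong (suc n) hf hg =
  cong₂ _+_ (⊛-cong n (λ i i≤n → hf (suc i) (s≤s i≤n)) (λ i i≤n → hg i (m≤n⇒m≤1+n i≤n)))
            (⊛-cong n (λ i i≤n → hf i (m≤n⇒m≤1+n i≤n)) (λ i i≤n → hg (suc i) (s≤s i≤n)))

⊛-congʳ : ∀ n (f : Seq) {g g′ : Seq} → (∀ i → i ≤ n → g i ≡ g′ i) → (f ⊛ g) n ≡ (f ⊛ g′) n
⊛-congʳ n f = ⊛-cong n (λ _ _ → refl)

⊛-congˡ : ∀ n {f f′ : Seq} (g : Seq) → (∀ i → i ≤ n → f i ≡ f′ i) → (f ⊛ g) n ≡ (f′ ⊛ g) n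
⊛-congˡ n g hf = ⊛-cong n hf (λ _ _ → refl)

⊛-comm : ∀ n (f g : Seq) → (f ⊛ g) n ≡ (g ⊛ f) n
⊛-comm zero    f g = *-comm (f 0) (g 0)
⊛-comm (suc n) f g =
  trans (cong₂ _+_ (⊛-comm n (D f) g) (⊛-comm n f (D g))) (+-comm ((g ⊛ D f) n) _)

⊛-distribˡ-+ : ∀ n (f g h : Seq) → (f ⊛ (λ i → g i + h i)) n ≡ (f ⊛ g) n + (f ⊛ h) n
⊛-distribˡ-+ zero    f g h = *-distribˡ-+ (f 0) (g 0) (h 0)
⊛-distribˡ-+ (suc n) f g h =
  trans (cong₂ _+_ (⊛-distribˡ-+ n (D f) g h) (⊛-distribˡ-+ n f (D g) (D h)))
        (+-interchange ((D f ⊛ g) n) _ _ _)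

⊛-distribʳ-+ : ∀ n (f g h : Seq) → ((λ i → f i + g i) ⊛ h) n ≡ (f ⊛ h) n + (g ⊛ h) n
⊛-distribʳ-+ n f g h = begin
  ((λ i → f i + g i) ⊛ h) n ≡⟨ ⊛-comm n _ h ⟩
  (h ⊛ (λ i → f i + g i)) n ≡⟨ ⊛-distribˡ-+ n h f g ⟩
  (h ⊛ f) n + (h ⊛ g) n     ≡⟨ cong₂ _+_ (⊛-comm n h f) (⊛-comm n h g) ⟩
  (f ⊛ h) n + (g ⊛ h) n     ∎

⊛-*ʳ : ∀ n c (f g : Seq) → (f ⊛ (λ i → c * g i)) n ≡ c * (f ⊛ g) n
⊛-*ʳ zero    c f g = x∙yz≈y∙xz (f 0) c (g 0)
⊛-*ʳ (suc n) c f g =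
  trans (cong₂ _+_ (⊛-*ʳ n c (D f) g) (⊛-*ʳ n c f (D g))) (sym (*-distribˡ-+ c _ _))

⊛-*ˡ : ∀ n c (f g : Seq) → ((λ i → c * f i) ⊛ g) n ≡ c * (f ⊛ g) n
⊛-*ˡ n c f g = trans (⊛-comm n _ g) (trans (⊛-*ʳ n c g f) (cong (c *_) (⊛-comm n g f)))

⊛-zeroʳ : ∀ n (f g : Seq) → (∀ i → i ≤ n → g i ≡ 0) → (f ⊛ g) n ≡ 0
⊛-zeroʳ zero    f g g≡0 = trans (cong (f 0 *_) (g≡0 0 z≤n)) (*-zeroʳ (f 0))
⊛-zeroʳ (suc n) f g g≡0 =
  cong₂ _+_ (⊛-zeroʳ n (D f) g (λ i i≤n → g≡0 i (m≤n⇒m≤1+n i≤n)))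
            (⊛-zeroʳ n f (D g) (λ i i≤n → g≡0 (suc i) (s≤s i≤n)))

⊛-Σ<ʳ : ∀ n m (f : Seq) (g : ℕ → Seq) →
        (f ⊛ (λ i → Σ< m (λ j → g j i))) n ≡ Σ< m (λ j → (f ⊛ g j) n)
⊛-Σ<ʳ n zero    f g = ⊛-zeroʳ n f _ (λ _ _ → refl)
⊛-Σ<ʳ n (suc m) f g = trans (⊛-distribˡ-+ n f _ (g m)) (cong (_+ (f ⊛ g m) n) (⊛-Σ<ʳ n m f g))

⊛-assoc : ∀ n (f g h : Seq) → ((f ⊛ g) ⊛ h) n ≡ (f ⊛ (g ⊛ h)) n
⊛-assoc zero    f g h = *-assoc (f 0) (g 0) (h 0)
⊛-assoc (suc n) f g h = begin
  (D (f ⊛ g) ⊛ h) n + ((f ⊛ g) ⊛ D h) n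
    ≡⟨ cong (_+ ((f ⊛ g) ⊛ D h) n) (⊛-distribʳ-+ n (D f ⊛ g) (f ⊛ D g) h) ⟩
  ((D f ⊛ g) ⊛ h) n + ((f ⊛ D g) ⊛ h) n + ((f ⊛ g) ⊛ D h) n
    ≡⟨ cong₂ _+_ (cong₂ _+_ (⊛-assoc n (D f) g h) (⊛-assoc n f (D g) h)) (⊛-assoc n f g (D h)) ⟩
  (D f ⊛ (g ⊛ h)) n + (f ⊛ (D g ⊛ h)) n + (f ⊛ (g ⊛ D h)) n
    ≡⟨ +-assoc ((D f ⊛ (g ⊛ h)) n) _ _ ⟩
  (D f ⊛ (g ⊛ h)) n + ((f ⊛ (D g ⊛ h)) n + (f ⊛ (g ⊛ D h)) n)
    ≡⟨ cong ((D f ⊛ (g ⊛ h)) n +_) (⊛-distribˡ-+ n f (D g ⊛ h) (g ⊛ D h)) ⟨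
  (D f ⊛ (g ⊛ h)) n + (f ⊛ D (g ⊛ h)) n ∎

⊛-rotate : ∀ n (f g h : Seq) → (f ⊛ (g ⊛ h)) n ≡ (g ⊛ (f ⊛ h)) n
⊛-rotate n f g h = begin
  (f ⊛ (g ⊛ h)) n ≡⟨ ⊛-assoc n f g h ⟨
  ((f ⊛ g) ⊛ h) n ≡⟨ ⊛-congˡ n h (λ i _ → ⊛-comm i f g) ⟩
  ((g ⊛ f) ⊛ h) n ≡⟨ ⊛-assoc n g f h ⟩
  (g ⊛ (f ⊛ h)) n ∎

basis : ℕ → Seq
basis zero    zero    = 1
basis zero    (suc _) = 0
basis (suc k) zero    = 0
basis (suc k) (suc i) = basis k i

δ : Seq
δ = basis 0

basis-same : ∀ k → basis k k ≡ 1
basis-same zero    = refl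
basis-same (suc k) = basis-same k

basis-other : ∀ k i → i ≢ k → basis k i ≡ 0
basis-other zero    zero    i≢k = ⊥-elim (i≢k refl)
basis-other zero    (suc i) i≢k = refl
basis-other (suc k) zero    i≢k = refl
basis-other (suc k) (suc i) i≢k = basis-other k i (i≢k ∘ cong suc)

⊛-basis : ∀ n k (f : Seq) → (f ⊛ basis k) n ≡ (n C k) * f (n ∸ k)
⊛-basis zero    zero    f = trans (*-identityʳ (f 0)) (sym (*-identityˡ (f 0)))
⊛-basis zero    (suc k) f = *-zeroʳ (f 0)
⊛-basis (suc n) zero    f =
  trans (cong₂ _+_ (⊛-basis n 0 (D f)) (⊛-zeroʳ n f (λ _ → 0) (λ _ _ → refl))) (+-identityʳ _)
⊛-basis (suc n) (suc k) f = begin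
  (D f ⊛ basis (suc k)) n + (f ⊛ basis k) n
    ≡⟨ cong₂ _+_ (⊛-basis n (suc k) (D f)) (⊛-basis n k f) ⟩
  (n C suc k) * f (suc (n ∸ suc k)) + (n C k) * f (n ∸ k)
    ≡⟨ cong (_+ (n C k) * f (n ∸ k)) realign ⟩
  (n C suc k) * f (n ∸ k) + (n C k) * f (n ∸ k)
    ≡⟨ *-distribʳ-+ (f (n ∸ k)) (n C suc k) (n C k) ⟨
  (n C suc k + n C k) * f (n ∸ k)
    ≡⟨ cong (_* f (n ∸ k)) (trans (+-comm (n C suc k) _) (nCk+nC[k+1]≡[n+1]C[k+1] n k)) ⟩
  (suc n C suc k) * f (n ∸ k) ∎
  where
  realign : (n C suc k) * f (suc (n ∸ suc k)) ≡ (n C suc k) * f (n ∸ k)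
  realign with k <? n
  ... | yes k<n = cong (λ i → (n C suc k) * f i) (sym (+-∸-assoc 1 k<n))
  ... | no  k≮n rewrite k>n⇒nCk≡0 {n} {suc k} (s≤s (≮⇒≥ k≮n)) = refl

⊛-δ : ∀ n (f : Seq) → (f ⊛ δ) n ≡ f n
⊛-δ n f = trans (⊛-basis n 0 f) (*-identityˡ (f n))

basis⊛basis : ∀ m k j → (basis m ⊛ basis k) j ≡ ((m + k) C m) * basis (m + k) j
basis⊛basis m k j with j ≟ m + k
... | yes refl = begin
  (basis m ⊛ basis k) (m + k)          ≡⟨ ⊛-basis (m + k) k (basis m) ⟩
  ((m + k) C k) * basis m (m + k ∸ k)  ≡⟨ cong₂ (λ c i → c * basis m i) symmetric (m+n∸n≡m m k) ⟩
  ((m + k) C m) * basis m m            ≡⟨ cong (((m + k) C m) *_) (trans (basis-same m) (sym (basis-same (m + k)))) ⟩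
  ((m + k) C m) * basis (m + k) (m + k) ∎
  where
  symmetric : (m + k) C k ≡ (m + k) C m
  symmetric = trans (nCk≡nC[n∸k] (m≤n+m k m)) (cong ((m + k) C_) (m+n∸n≡m m k))
... | no j≢m+k = begin
  (basis m ⊛ basis k) j          ≡⟨ ⊛-basis j k (basis m) ⟩
  (j C k) * basis m (j ∸ k)      ≡⟨ vanish (k ≤? j) ⟩
  0                              ≡⟨ *-zeroʳ ((m + k) C m) ⟨
  ((m + k) C m) * 0              ≡⟨ cong (((m + k) C m) *_) (basis-other (m + k) j j≢m+k) ⟨
  ((m + k) C m) * basis (m + k) j ∎
  where
  vanish : Dec (k ≤ j) → (j C k) * basis m (j ∸ k) ≡ 0
  vanish (yes k≤j) = trans (cong ((j C k) *_) (basis-other m (j ∸ k) (λ j∸k≡m → j≢m+k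
                       (trans (sym (m∸n+n≡m k≤j)) (cong (_+ k) j∸k≡m)))))
                           (*-zeroʳ (j C k))
  vanish (no  k≰j) = cong (_* basis m (j ∸ k)) (k>n⇒nCk≡0 (≰⇒> k≰j))

-- Partial Bell polynomials and composition

-- bell a r n = B_{n,r}(a₁, a₂, …); the recursion is (A^{r+1}/(r+1)!)′ = A′ · Aʳ/r!.  a 0 is never used.
bell : Seq → ℕ → Seq
bell a zero            = δ
bell a (suc r) zero    = 0
bell a (suc r) (suc n) = (D a ⊛ bell a r) n

bell-cong : ∀ r n (a b : Seq) → (∀ i → i < n → a (suc i) ≡ b (suc i)) → bell a r n ≡ bell b r n
bell-cong zero    n       a b h = refl
bell-cong (suc r) zero    a b h = refl
bell-cong (suc r) (suc n) a b h =
  ⊛-cong n (λ i i≤n → h i (s≤s i≤n))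
           (λ i i≤n → bell-cong r i a b (λ j j<i → h j (<-≤-trans j<i (m≤n⇒m≤1+n i≤n))))

bell-vanish : ∀ r n (a : Seq) → n < r → bell a r n ≡ 0
bell-vanish (suc r) zero    a _         = refl
bell-vanish (suc r) (suc n) a (s≤s n<r) =
  ⊛-zeroʳ n (D a) (bell a r) (λ i i≤n → bell-vanish r i a (≤-<-trans i≤n n<r))

-- The coefficients of G(A(x)), with a 0 ignored (as if A(0) = 0).
infixl 9 _∘ₑ_

_∘ₑ_ : Seq → Seq → Seq
(g ∘ₑ a) m = Σ< (suc m) (λ i → bell a i m * g i)

∘ₑ-extend : ∀ a g m N → m < N → Σ< N (λ i → bell a i m * g i) ≡ (g ∘ₑ a) m
∘ₑ-extend a g m N m<N = Σ<-extend _ m<N (λ i m<i → cong (_* g i) (bell-vanish i m a m<i))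

∘ₑ-+ : ∀ a (g h : Seq) m → ((λ i → g i + h i) ∘ₑ a) m ≡ (g ∘ₑ a) m + (h ∘ₑ a) m
∘ₑ-+ a g h m = trans (Σ<-cong (suc m) (λ i _ → *-distribˡ-+ (bell a i m) (g i) (h i))) (Σ<-+ (suc m) _ _)

δ-∘ₑ : ∀ a m → (δ ∘ₑ a) m ≡ δ m
δ-∘ₑ a m = trans (Σ<-single (suc m) 0 _ z<s others-zero) (*-identityʳ (δ m))
  where
  others-zero : ∀ i → i ≢ 0 → bell a i m * δ i ≡ 0
  others-zero zero    0≢0 = ⊥-elim (0≢0 refl)
  others-zero (suc i) _   = *-zeroʳ (bell a (suc i) m)

∘ₑ-chainRule : ∀ a g m → (g ∘ₑ a) (suc m) ≡ (D a ⊛ (D g ∘ₑ a)) m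
∘ₑ-chainRule a g m = begin
  (g ∘ₑ a) (suc m)
    ≡⟨ Σ<-head (suc m) _ ⟩
  Σ< (suc m) (λ i → (D a ⊛ bell a i) m * g (suc i))
    ≡⟨ Σ<-cong (suc m) (λ i _ → trans (*-comm _ (g (suc i))) (sym (⊛-*ʳ m (g (suc i)) (D a) (bell a i)))) ⟩
  Σ< (suc m) (λ i → (D a ⊛ (λ j → g (suc i) * bell a i j)) m)
    ≡⟨ ⊛-Σ<ʳ m (suc m) (D a) _ ⟨
  (D a ⊛ (λ j → Σ< (suc m) (λ i → g (suc i) * bell a i j))) m
    ≡⟨ ⊛-congʳ m (D a) (λ j j≤m → trans (Σ<-cong (suc m) (λ i _ → *-comm (g (suc i)) _))
                                        (∘ₑ-extend a (D g) j (suc m) (s≤s j≤m))) ⟩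
  (D a ⊛ (D g ∘ₑ a)) m ∎

-- Stated for all j ≤ m so that the induction on m applies at every smaller index.
∘ₑ-⊛ : ∀ a m (g h : Seq) → ∀ j → j ≤ m → ((g ⊛ h) ∘ₑ a) j ≡ ((g ∘ₑ a) ⊛ (h ∘ₑ a)) j
∘ₑ-⊛ a zero g h zero z≤n = begin
  0 + 1 * (g 0 * h 0)             ≡⟨ *-identityˡ (g 0 * h 0) ⟩
  g 0 * h 0                       ≡⟨ cong₂ _*_ (*-identityˡ (g 0)) (*-identityˡ (h 0)) ⟨
  (0 + 1 * g 0) * (0 + 1 * h 0)   ∎
∘ₑ-⊛ a (suc m) g h j j≤1+m with m≤n⇒m<n∨m≡n j≤1+m
... | inj₁ (s≤s j≤m) = ∘ₑ-⊛ a m g h j j≤m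
... | inj₂ refl = begin
  ((g ⊛ h) ∘ₑ a) (suc m)
    ≡⟨ ∘ₑ-chainRule a (g ⊛ h) m ⟩
  (D a ⊛ ((λ i → (D g ⊛ h) i + (g ⊛ D h) i) ∘ₑ a)) m
    ≡⟨ ⊛-congʳ m (D a) (λ i i≤m → trans (∘ₑ-+ a _ _ i)
         (cong₂ _+_ (∘ₑ-⊛ a m (D g) h i i≤m) (∘ₑ-⊛ a m g (D h) i i≤m))) ⟩
  (D a ⊛ (λ i → ((D g ∘ₑ a) ⊛ (h ∘ₑ a)) i + ((g ∘ₑ a) ⊛ (D h ∘ₑ a)) i)) m
    ≡⟨ ⊛-distribˡ-+ m (D a) _ _ ⟩
  (D a ⊛ ((D g ∘ₑ a) ⊛ (h ∘ₑ a))) m + (D a ⊛ ((g ∘ₑ a) ⊛ (D h ∘ₑ a))) m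
    ≡⟨ cong₂ _+_ (sym (⊛-assoc m (D a) _ _)) (⊛-rotate m (D a) _ _) ⟩
  ((D a ⊛ (D g ∘ₑ a)) ⊛ (h ∘ₑ a)) m + ((g ∘ₑ a) ⊛ (D a ⊛ (D h ∘ₑ a))) m
    ≡⟨ cong₂ _+_ (⊛-congˡ m (h ∘ₑ a) (λ i _ → ∘ₑ-chainRule a g i))
                 (⊛-congʳ m (g ∘ₑ a) (λ i _ → ∘ₑ-chainRule a h i)) ⟨
  ((g ∘ₑ a) ⊛ (h ∘ₑ a)) (suc m) ∎

-- Faà di Bruno: (Cʳ/r!) ∘ A = (C ∘ A)ʳ/r!.
bell-∘ₑ : ∀ a c r m → (bell c r ∘ₑ a) m ≡ bell (c ∘ₑ a) r m
bell-∘ₑ a c zero    m       = δ-∘ₑ a m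
bell-∘ₑ a c (suc r) zero    = refl
bell-∘ₑ a c (suc r) (suc m) = begin
  (bell c (suc r) ∘ₑ a) (suc m)
    ≡⟨ ∘ₑ-chainRule a (bell c (suc r)) m ⟩
  (D a ⊛ ((D c ⊛ bell c r) ∘ₑ a)) m
    ≡⟨ ⊛-congʳ m (D a) (λ i _ → ∘ₑ-⊛ a i (D c) (bell c r) i ≤-refl) ⟩
  (D a ⊛ ((D c ∘ₑ a) ⊛ (bell c r ∘ₑ a))) m
    ≡⟨ ⊛-congʳ m (D a) (λ i _ → ⊛-congʳ i (D c ∘ₑ a) (λ j _ → bell-∘ₑ a c r j)) ⟩
  (D a ⊛ ((D c ∘ₑ a) ⊛ bell (c ∘ₑ a) r)) m
    ≡⟨ ⊛-assoc m (D a) _ _ ⟨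
  ((D a ⊛ (D c ∘ₑ a)) ⊛ bell (c ∘ₑ a) r) m
    ≡⟨ ⊛-congˡ m (bell (c ∘ₑ a) r) (λ i _ → ∘ₑ-chainRule a c i) ⟨
  bell (c ∘ₑ a) (suc r) (suc m) ∎

basis-∘ₑ : ∀ a k m → (basis k ∘ₑ a) m ≡ bell a k m
basis-∘ₑ a k m = begin
  (basis k ∘ₑ a) m
    ≡⟨ ∘ₑ-extend a (basis k) m (suc (k + m)) (s≤s (m≤n+m m k)) ⟨
  Σ< (suc (k + m)) (λ i → bell a i m * basis k i)
    ≡⟨ Σ<-single (suc (k + m)) k _ (s≤s (m≤m+n k m))
         (λ i i≢k → trans (cong (bell a i m *_) (basis-other k i i≢k)) (*-zeroʳ (bell a i m))) ⟩
  bell a k m * basis k k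
    ≡⟨ trans (cong (bell a k m *_) (basis-same k)) (*-identityʳ _) ⟩
  bell a k m ∎

-- Stirling numbers and T

-- A · Aʳ/r! = (r+1) · A^{r+1}/(r+1)!, obtained by composing the same identity for monomials with A.
bell-1⊛bell : ∀ a r n → (bell a 1 ⊛ bell a r) n ≡ suc r * bell a (suc r) n
bell-1⊛bell a r n = begin
  (bell a 1 ⊛ bell a r) n
    ≡⟨ ⊛-cong n (λ i _ → sym (basis-∘ₑ a 1 i)) (λ i _ → sym (basis-∘ₑ a r i)) ⟩
  ((basis 1 ∘ₑ a) ⊛ (basis r ∘ₑ a)) n
    ≡⟨ ∘ₑ-⊛ a n (basis 1) (basis r) n ≤-refl ⟨
  ((basis 1 ⊛ basis r) ∘ₑ a) n
    ≡⟨ Σ<-cong (suc n) (λ i _ → cong (bell a i n *_)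
         (trans (basis⊛basis 1 r i) (cong (_* basis (suc r) i) (nC1≡n (suc r))))) ⟩
  Σ< (suc n) (λ i → bell a i n * (suc r * basis (suc r) i))
    ≡⟨ Σ<-cong (suc n) (λ i _ → x∙yz≈y∙xz (bell a i n) (suc r) _) ⟩
  Σ< (suc n) (λ i → suc r * (bell a i n * basis (suc r) i))
    ≡⟨ Σ<-*ˡ (suc n) (suc r) _ ⟨
  suc r * (basis (suc r) ∘ₑ a) n
    ≡⟨ cong (suc r *_) (basis-∘ₑ a (suc r) n) ⟩
  suc r * bell a (suc r) n ∎

one : Seq
one _ = 1

-- one encodes A(x) = eˣ − 1 (a 0 is irrelevant); A′ = A + 1 gives the recurrence of S.
S≡bell : ∀ n r → S n r ≡ bell one r n
S≡bell zero    zero    = refl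
S≡bell zero    (suc r) = refl
S≡bell (suc n) zero    = refl
S≡bell (suc n) (suc r) = begin
  suc r * S n (suc r) + S n r
    ≡⟨ cong₂ (λ x y → suc r * x + y) (S≡bell n (suc r)) (S≡bell n r) ⟩
  suc r * bell one (suc r) n + bell one r n
    ≡⟨ cong₂ _+_ (bell-1⊛bell one r n) (trans (⊛-comm n δ (bell one r)) (⊛-δ n (bell one r))) ⟨
  (bell one 1 ⊛ bell one r) n + (δ ⊛ bell one r) n
    ≡⟨ ⊛-distribʳ-+ n (bell one 1) δ (bell one r) ⟨
  ((λ i → bell one 1 i + δ i) ⊛ bell one r) n
    ≡⟨ ⊛-congˡ n (bell one r) (λ i _ → one≡bell-1+δ i) ⟨
  (one ⊛ bell one r) n ∎
  where
  one≡bell-1+δ : ∀ i → 1 ≡ bell one 1 i + δ i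
  one≡bell-1+δ zero    = refl
  one≡bell-1+δ (suc i) = sym (trans (+-identityʳ _) (⊛-δ i one))

S-vanish : ∀ n r → n < r → S n r ≡ 0
S-vanish n r n<r = trans (S≡bell n r) (bell-vanish r n one n<r)

-- chainSum k n r is T(n, k+1, r); the ordering i_{j−1} ≥ i_j is automatic since S(a, b) = 0 for a < b.
chainSum : ℕ → ℕ → ℕ → ℕ
chainSum zero    n r = S n r
chainSum (suc k) n r = Σ< (suc n) (λ i → S n i * chainSum k i r)

chainSum-vanish : ∀ k n r → n < r → chainSum k n r ≡ 0
chainSum-vanish zero    n r n<r = S-vanish n r n<r
chainSum-vanish (suc k) n r n<r = Σ<-zero (suc n) _ (λ i i≤n →
  trans (cong (S n i *_) (chainSum-vanish k i r (≤-<-trans (≤-pred i≤n) n<r))) (*-zeroʳ (S n i)))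

chainTotal : ℕ → Seq
chainTotal k p = Σ< (suc p) (chainSum k p)

chainGen : ℕ → Seq
chainGen zero    = one
chainGen (suc k) = chainTotal k

chainGen-∘ₑ : ∀ k p → (chainGen k ∘ₑ one) p ≡ chainTotal k p
chainGen-∘ₑ zero    p = Σ<-cong (suc p) (λ i _ → trans (*-identityʳ _) (sym (S≡bell p i)))
chainGen-∘ₑ (suc k) p = begin
  Σ< (suc p) (λ i → bell one i p * Σ< (suc i) (chainSum k i))
    ≡⟨ Σ<-cong (suc p) (λ i i≤p → cong₂ _*_ (sym (S≡bell p i))
         (sym (Σ<-extend (chainSum k i) i≤p (λ j i<j → chainSum-vanish k i j i<j)))) ⟩
  Σ< (suc p) (λ i → S p i * Σ< (suc p) (chainSum k i))
    ≡⟨ Σ<-cong (suc p) (λ i _ → Σ<-*ˡ (suc p) (S p i) (chainSum k i)) ⟩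
  Σ< (suc p) (λ i → Σ< (suc p) (λ j → S p i * chainSum k i j))
    ≡⟨ Σ<-swap (suc p) (suc p) _ ⟩
  chainTotal (suc k) p ∎

chainSum≡bell : ∀ k n r → chainSum k n r ≡ bell (chainGen k) r n
chainSum≡bell zero    n r = S≡bell n r
chainSum≡bell (suc k) n r = begin
  chainSum (suc k) n r
    ≡⟨ Σ<-cong (suc n) (λ i _ → cong₂ _*_ (S≡bell n i) (chainSum≡bell k i r)) ⟩
  (bell (chainGen k) r ∘ₑ one) n
    ≡⟨ bell-∘ₑ one (chainGen k) r n ⟩
  bell (chainGen k ∘ₑ one) r n
    ≡⟨ bell-cong r n _ _ (λ i _ → chainGen-∘ₑ k (suc i)) ⟩
  bell (chainTotal k) r n ∎

sumMap : {A : Set} → (A → ℕ) → List A → ℕ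
sumMap g xs = sum (map g xs)

sumMap-cong : ∀ {A : Set} {g h : A → ℕ} xs → (∀ x → g x ≡ h x) → sumMap g xs ≡ sumMap h xs
sumMap-cong xs g≗h = cong sum (map-cong g≗h xs)

sumMap-congᴬ : ∀ {A : Set} {P : A → Set} {g h : A → ℕ} {xs} →
               All P xs → (∀ {x} → P x → g x ≡ h x) → sumMap g xs ≡ sumMap h xs
sumMap-congᴬ ps g≗h = cong sum (map-cong-local (All.map g≗h ps))

sumMap-map : ∀ {A B : Set} (g : B → ℕ) (f : A → B) xs → sumMap g (map f xs) ≡ sumMap (g ∘ f) xs
sumMap-map g f xs = cong sum (sym (map-∘ xs))

sumMap-++ : ∀ {A : Set} (g : A → ℕ) xs ys → sumMap g (xs ++ ys) ≡ sumMap g xs + sumMap g ys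
sumMap-++ g xs ys = trans (cong sum (map-++ g xs ys)) (sum-++ (map g xs) (map g ys))

sumMap-concatMap : ∀ {A B : Set} (g : B → ℕ) (h : A → List B) xs →
                   sumMap g (concatMap h xs) ≡ sumMap (λ x → sumMap g (h x)) xs
sumMap-concatMap g h []       = refl
sumMap-concatMap g h (x ∷ xs) =
  trans (sumMap-++ g (h x) (concatMap h xs)) (cong (sumMap g (h x) +_) (sumMap-concatMap g h xs))

sumMap-*ˡ : ∀ {A : Set} c (g : A → ℕ) xs → sumMap (λ x → c * g x) xs ≡ c * sumMap g xs
sumMap-*ˡ c g []       = sym (*-zeroʳ c)
sumMap-*ˡ c g (x ∷ xs) = trans (cong (c * g x +_) (sumMap-*ˡ c g xs)) (sym (*-distribˡ-+ c (g x) _))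

sumMap-filter : ∀ {A : Set} {P : A → Set} (P? : Decidable P) (g : A → ℕ) xs →
                (∀ x → ¬ P x → g x ≡ 0) → sumMap g (filter P? xs) ≡ sumMap g xs
sumMap-filter P? g []       g≡0 = refl
sumMap-filter P? g (x ∷ xs) g≡0 with P? x
... | yes _  = cong (g x +_) (sumMap-filter P? g xs g≡0)
... | no ¬px = trans (sumMap-filter P? g xs g≡0) (cong (_+ sumMap g xs) (sym (g≡0 x ¬px)))

guard : {P : Set} → Dec P → ℕ → ℕ
guard (yes _) v = v
guard (no _)  _ = 0

guard-yes : ∀ {P : Set} (d : Dec P) v → P → guard d v ≡ v
guard-yes (yes _) v _  = refl
guard-yes (no ¬p) v p  = ⊥-elim (¬p p)

guard-no : ∀ {P : Set} (d : Dec P) v → ¬ P → guard d v ≡ 0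
guard-no (yes p) v ¬p = ⊥-elim (¬p p)
guard-no (no _)  v _  = refl

guard-⇔ : ∀ {P Q : Set} (p : Dec P) (q : Dec Q) v → (P → Q) → (Q → P) → guard p v ≡ guard q v
guard-⇔ (yes p) q v P→Q _   = sym (guard-yes q v (P→Q p))
guard-⇔ (no ¬p) q v _   Q→P = sym (guard-no q v (¬p ∘ Q→P))

guard-×-dec : ∀ {P Q : Set} (p : Dec P) (q : Dec Q) v → guard (p ×-dec q) v ≡ guard p (guard q v)
guard-×-dec (yes p) (yes q) v = refl
guard-×-dec (yes p) (no _)  v = refl
guard-×-dec (no _)  q       v = refl

sumMap-guard : ∀ {A : Set} {P : Set} (d : Dec P) (g : A → ℕ) xs →
               sumMap (λ x → guard d (g x)) xs ≡ guard d (sumMap g xs)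
sumMap-guard (yes _) g xs       = refl
sumMap-guard (no _)  g []       = refl
sumMap-guard (no ¬p) g (x ∷ xs) = sumMap-guard (no ¬p) g xs

sumMap-filter-guard : ∀ {A : Set} {P : A → Set} (P? : Decidable P) (g : A → ℕ) xs →
                      sumMap g (filter P? xs) ≡ sumMap (λ x → guard (P? x) (g x)) xs
sumMap-filter-guard P? g []       = refl
sumMap-filter-guard P? g (x ∷ xs) with P? x
... | yes _ = cong (g x +_) (sumMap-filter-guard P? g xs)
... | no  _ = sumMap-filter-guard P? g xs

sumMap-applyUpTo : ∀ (g f : Seq) m → sumMap g (applyUpTo f m) ≡ Σ< m (g ∘ f)
sumMap-applyUpTo g f zero    = refl
sumMap-applyUpTo g f (suc m) =
  trans (cong (g (f 0) +_) (sumMap-applyUpTo g (f ∘ suc) m)) (sym (Σ<-head m (g ∘ f)))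

sumMap-range : ∀ lo hi a (F : Seq) → a ≤ hi → (∀ i → i < lo → F i ≡ 0) → (∀ i → a < i → F i ≡ 0) →
               sumMap F (range lo hi) ≡ Σ< (suc a) F
sumMap-range lo hi a F a≤hi below above = begin
  sumMap F (range lo hi)
    ≡⟨ sumMap-applyUpTo F (lo +_) (suc hi ∸ lo) ⟩
  Σ< (suc hi ∸ lo) (λ j → F (lo + j))
    ≡⟨ cong (_+ Σ< (suc hi ∸ lo) (λ j → F (lo + j))) (Σ<-zero lo F below) ⟨
  Σ< lo F + Σ< (suc hi ∸ lo) (λ j → F (lo + j))
    ≡⟨ Σ<-shift lo (suc hi ∸ lo) F ⟩
  Σ< (lo + (suc hi ∸ lo)) F
    ≡⟨ Σ<-extend F (≤-trans (s≤s a≤hi) (m≤n+m∸n (suc hi) lo)) above ⟩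
  Σ< (suc a) F ∎

chainProd-unsorted : ∀ xs → ¬ NonIncreasing xs → chainProd xs ≡ 0
chainProd-unsorted []           unsorted = ⊥-elim (unsorted [])
chainProd-unsorted (x ∷ [])     unsorted = ⊥-elim (unsorted [-])
chainProd-unsorted (x ∷ y ∷ xs) unsorted = headPair (y ≤? x) (chainProd-unsorted (y ∷ xs))
  where
  headPair : Dec (y ≤ x) → (¬ NonIncreasing (y ∷ xs) → chainProd (y ∷ xs) ≡ 0) →
             S x y * chainProd (y ∷ xs) ≡ 0
  headPair (yes y≤x) tail-unsorted =
    trans (cong (S x y *_) (tail-unsorted (unsorted ∘ (y≤x ∷_)))) (*-zeroʳ (S x y))
  headPair (no y≰x)  _ = cong (_* chainProd (y ∷ xs)) (S-vanish x y (≰⇒> y≰x))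

chainProd-tuples : ∀ r len a hi → a ≤ hi →
                   sumMap (λ is → chainProd (a ∷ is ++ [ r ])) (tuples len r hi) ≡ chainSum len a r
chainProd-tuples r zero      a hi a≤hi = trans (+-identityʳ _) (*-identityʳ (S a r))
chainProd-tuples r (suc len) a hi a≤hi = begin
  sumMap (λ is → chainProd (a ∷ is ++ [ r ])) (tuples (suc len) r hi)
    ≡⟨ sumMap-concatMap _ _ (range r hi) ⟩
  sumMap (λ i → sumMap (λ is → chainProd (a ∷ is ++ [ r ])) (map (i ∷_) (tuples len r hi))) (range r hi)
    ≡⟨ sumMap-cong (range r hi) (λ i → trans (sumMap-map _ (i ∷_) (tuples len r hi))
         (sumMap-*ˡ (S a i) (λ is → chainProd (i ∷ is ++ [ r ])) (tuples len r hi))) ⟩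
  sumMap (λ i → S a i * sumMap (λ is → chainProd (i ∷ is ++ [ r ])) (tuples len r hi)) (range r hi)
    ≡⟨ sumMap-cong (range r hi) inner ⟩
  sumMap (λ i → S a i * chainSum len i r) (range r hi)
    ≡⟨ sumMap-range r hi a _ a≤hi
         (λ i i<r → trans (cong (S a i *_) (chainSum-vanish len i r i<r)) (*-zeroʳ (S a i)))
         (λ i a<i → cong (_* chainSum len i r) (S-vanish a i a<i)) ⟩
  chainSum (suc len) a r ∎
  where
  inner : ∀ i → S a i * sumMap (λ is → chainProd (i ∷ is ++ [ r ])) (tuples len r hi) ≡ S a i * chainSum len i r
  inner i with i ≤? a
  ... | yes i≤a = cong (S a i *_) (chainProd-tuples r len i hi (≤-trans i≤a a≤hi))
  ... | no  i≰a rewrite S-vanish a i (≰⇒> i≰a) = refl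

T≡chainSum : ∀ n k r → T n (suc k) r ≡ chainSum k n r
T≡chainSum n k r =
  trans (sumMap-filter (λ is → linked? _≥?_ (n ∷ is ++ [ r ])) _ (tuples k r n)
                       (λ is → chainProd-unsorted (n ∷ is ++ [ r ])))
        (chainProd-tuples r k n n ≤-refl)

-- The coefficients f_λ

C*!*!≡! : ∀ k m → ((k + m) C k) * (k ! * m !) ≡ (k + m) !
C*!*!≡! k m = begin
  ((k + m) C k) * (k ! * m !)
    ≡⟨ cong (λ i → ((k + m) C k) * (k ! * i !)) (m+n∸m≡n k m) ⟨
  ((k + m) C k) * (k ! * (k + m ∸ k) !)
    ≡⟨ cong (_* (k ! * (k + m ∸ k) !)) (nCk≡n!/k![n-k]! (m≤m+n k m)) ⟩
  ((k + m) ! / (k ! * (k + m ∸ k) !)) * (k ! * (k + m ∸ k) !)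
    ≡⟨ m/n*n≡m (k![n∸k]!∣n! (m≤m+n k m)) ⟩
  (k + m) ! ∎
  where
  instance
    k!*[k+m∸k]!≢0 : NonZero (k ! * (k + m ∸ k) !)
    k!*[k+m∸k]!≢0 = k !* (k + m ∸ k) !≢0

-- blockCount M t counts the ways to split t·(M+1) labelled points into t unlabelled blocks of
-- size M+1: the block of the first point is fixed by choosing its M other members.
blockCount : ℕ → ℕ → ℕ
blockCount M zero    = 1
blockCount M (suc t) = ((M + t * suc M) C M) * blockCount M t

blockCount*!≡! : ∀ M t → blockCount M t * ((suc M !) ^ t * t !) ≡ (t * suc M) !
blockCount*!≡! M zero    = refl
blockCount*!≡! M (suc t) = begin
  ((M + N) C M) * blockCount M t * ((suc M * M ! * (suc M !) ^ t) * (suc t * t !))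
    ≡⟨ rearrange ((M + N) C M) (blockCount M t) (M !) ((suc M !) ^ t) (t !) (suc M) (suc t) ⟩
  ((M + N) C M) * (M ! * (blockCount M t * ((suc M !) ^ t * t !))) * (suc M * suc t)
    ≡⟨ cong (λ z → ((M + N) C M) * (M ! * z) * (suc M * suc t)) (blockCount*!≡! M t) ⟩
  ((M + N) C M) * (M ! * N !) * (suc M * suc t)
    ≡⟨ cong₂ _*_ (C*!*!≡! M N) (*-comm (suc M) (suc t)) ⟩
  (M + N) ! * suc (M + N)
    ≡⟨ *-comm ((M + N) !) _ ⟩
  suc (M + N) ! ∎
  where
  N : ℕ
  N = t * suc M
  rearrange : ∀ c b m p s x y → c * b * ((x * m * p) * (y * s)) ≡ c * (m * (b * (p * s))) * (x * y)
  rearrange = solve-∀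

partFactor : ℕ → ℕ → ℕ
partFactor j m = ((j !) ^ m) * m !

mult-++ : ∀ j xs ys → mult j (xs ++ ys) ≡ mult j xs + mult j ys
mult-++ j xs ys = trans (cong length (filter-++ (j ≟_) xs ys)) (length-++ (filter (j ≟_) xs))

mult-replicate-self : ∀ k t → mult k (replicate t k) ≡ t
mult-replicate-self k zero    = refl
mult-replicate-self k (suc t) =
  trans (cong length (filter-accept (k ≟_) {k} {replicate t k} refl)) (cong suc (mult-replicate-self k t))

mult-absent : ∀ j l → All (j ≢_) l → mult j l ≡ 0
mult-absent j []      []          = refl
mult-absent j (x ∷ l) (j≢x ∷ j∉l) =
  trans (cong length (filter-reject (j ≟_) {x} {l} j≢x)) (mult-absent j l j∉l)

mult-above : ∀ {j m} l → All (_≤ m) l → m < j → mult j l ≡ 0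
mult-above l l≤m m<j = mult-absent _ l (All.map (λ v≤m j≡v → <⇒≱ m<j (subst (_≤ _) (sym j≡v) v≤m)) l≤m)

denom-++ : ∀ N xs ys → (∀ j → mult j xs ≡ 0 ⊎ mult j ys ≡ 0) → denom N (xs ++ ys) ≡ denom N xs * denom N ys
denom-++ zero    xs ys disjoint = refl
denom-++ (suc N) xs ys disjoint = begin
  denom N (xs ++ ys) * partFactor (suc N) (mult (suc N) (xs ++ ys))
    ≡⟨ cong₂ (λ d m → d * partFactor (suc N) m) (denom-++ N xs ys disjoint) (mult-++ (suc N) xs ys) ⟩
  denom N xs * denom N ys * partFactor (suc N) (mult (suc N) xs + mult (suc N) ys)
    ≡⟨ cong (denom N xs * denom N ys *_) (factor-split (disjoint (suc N))) ⟩
  denom N xs * denom N ys * (partFactor (suc N) (mult (suc N) xs) * partFactor (suc N) (mult (suc N) ys))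
    ≡⟨ [m*n]*[o*p]≡[m*o]*[n*p] (denom N xs) (denom N ys) _ _ ⟩
  denom (suc N) xs * denom (suc N) ys ∎
  where
  factor-split : ∀ {m n} → m ≡ 0 ⊎ n ≡ 0 → partFactor (suc N) (m + n) ≡ partFactor (suc N) m * partFactor (suc N) n
  factor-split (inj₁ refl) = sym (+-identityʳ _)
  factor-split {m} (inj₂ refl) rewrite +-identityʳ m = sym (*-identityʳ _)

denom-absent : ∀ N l → (∀ j → 1 ≤ j → j ≤ N → mult j l ≡ 0) → denom N l ≡ 1
denom-absent zero    l absent = refl
denom-absent (suc N) l absent =
  cong₂ (λ d m → d * partFactor (suc N) m)
        (denom-absent N l (λ j 1≤j j≤N → absent j 1≤j (m≤n⇒m≤1+n j≤N))) (absent (suc N) z<s ≤-refl)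

denom-extend : ∀ k m l → All (_≤ m) l → denom (k + m) l ≡ denom m l
denom-extend zero    m l l≤m = refl
denom-extend (suc k) m l l≤m = begin
  denom (k + m) l * partFactor (suc (k + m)) (mult (suc (k + m)) l)
    ≡⟨ cong₂ (λ d c → d * partFactor (suc (k + m)) c) (denom-extend k m l l≤m)
             (mult-above l l≤m (s≤s (m≤n+m m k))) ⟩
  denom m l * 1
    ≡⟨ *-identityʳ _ ⟩
  denom m l ∎

denom-replicate : ∀ N k t → 1 ≤ k → k ≤ N → denom N (replicate t k) ≡ partFactor k t
denom-replicate zero    k t 1≤k k≤0 = ⊥-elim (<⇒≱ 1≤k k≤0)
denom-replicate (suc N) k t 1≤k k≤1+N with k ≟ suc N
... | yes refl = begin
  denom N (replicate t k) * partFactor k (mult k (replicate t k))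
    ≡⟨ cong₂ (λ d m → d * partFactor k m) (denom-absent N _ below-k) (mult-replicate-self k t) ⟩
  1 * partFactor k t
    ≡⟨ *-identityˡ _ ⟩
  partFactor k t ∎
  where
  below-k : ∀ j → 1 ≤ j → j ≤ N → mult j (replicate t k) ≡ 0
  below-k j _ j≤N = mult-absent j _ (replicate⁺ t (<⇒≢ (s≤s j≤N)))
... | no k≢1+N = begin
  denom N (replicate t k) * partFactor (suc N) (mult (suc N) (replicate t k))
    ≡⟨ cong₂ (λ d m → d * partFactor (suc N) m) (denom-replicate N k t 1≤k (≤-pred (≤∧≢⇒< k≤1+N k≢1+N)))
             (mult-absent (suc N) _ (replicate⁺ t (k≢1+N ∘ sym))) ⟩
  partFactor k t * 1
    ≡⟨ *-identityʳ _ ⟩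
  partFactor k t ∎

denom-block : ∀ k t s → 1 ≤ k → denom (t * k + s) (replicate t k) ≡ partFactor k t
denom-block k zero    s _   = denom-absent s [] (λ _ _ _ → refl)
denom-block k (suc t) s 1≤k = denom-replicate _ k (suc t) 1≤k (≤-trans (m≤m+n k (t * k)) (m≤m+n _ s))

denom*q≡!⇒f≡q : ∀ N l q → denom N l * q ≡ N ! → f N l ≡ q
denom*q≡!⇒f≡q N l q denom*q≡N! = begin
  N ! / denom N l            ≡⟨ /-congˡ (trans (sym denom*q≡N!) (*-comm (denom N l) q)) ⟩
  q * denom N l / denom N l  ≡⟨ m*n/n≡m q (denom N l) ⟩
  q                          ∎
  where
  instance
    denom≢0 : NonZero (denom N l)
    denom≢0 = denom-nz N l

InRange : ℕ → ℕ → ℕ → Set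
InRange lo hi v = lo ≤ v × v ≤ hi

sum-bound : ∀ l → All (_≤ sum l) l
sum-bound []      = []
sum-bound (x ∷ l) = m≤m+n x (sum l) ∷ All.map (λ v≤ → ≤-trans v≤ (m≤n+m (sum l) x)) (sum-bound l)

sum-replicate : ∀ t k → sum (replicate t k) ≡ t * k
sum-replicate zero    k = refl
sum-replicate (suc t) k = cong (k +_) (sum-replicate t k)

-- A partition whose parts are at most M+1, written as t parts M+1 followed by parts in [1, M].
module TopBlock (M t : ℕ) (l : List ℕ) (l∈[1,M] : All (InRange 1 M) l) where
  K a s N : ℕ
  K = suc M
  a = t * K
  s = sum l
  N = a + s

  L : List ℕ
  L = replicate t K ++ l

  sum-L : sum L ≡ N
  sum-L = trans (sum-++ (replicate t K) l) (cong (_+ s) (sum-replicate t K))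

  denom-L : denom N L ≡ partFactor K t * denom s l
  denom-L = trans (denom-++ N (replicate t K) l disjoint)
                  (cong₂ _*_ (denom-block K t s z<s) (denom-extend a s l (sum-bound l)))
    where
    disjoint : ∀ j → mult j (replicate t K) ≡ 0 ⊎ mult j l ≡ 0
    disjoint j with j ≟ K
    ... | yes refl = inj₂ (mult-above l (All.map proj₂ l∈[1,M]) ≤-refl)
    ... | no  j≢K  = inj₁ (mult-absent j _ (replicate⁺ t j≢K))

  module _ (f*denom≡!-l : f s l * denom s l ≡ s !) where

    denom*quotient≡! : denom N L * ((N C a) * (blockCount M t * f s l)) ≡ N !
    denom*quotient≡! = begin
      denom N L * ((N C a) * (blockCount M t * f s l))
        ≡⟨ cong (_* ((N C a) * (blockCount M t * f s l))) denom-L ⟩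
      partFactor K t * denom s l * ((N C a) * (blockCount M t * f s l))
        ≡⟨ rearrange (partFactor K t) (denom s l) (N C a) (blockCount M t) (f s l) ⟩
      (N C a) * ((blockCount M t * partFactor K t) * (f s l * denom s l))
        ≡⟨ cong₂ (λ u v → (N C a) * (u * v)) (blockCount*!≡! M t) f*denom≡!-l ⟩
      (N C a) * (a ! * s !)
        ≡⟨ C*!*!≡! a s ⟩
      N ! ∎
      where
      rearrange : ∀ p d c b g → p * d * (c * (b * g)) ≡ c * ((b * p) * (g * d))
      rearrange = solve-∀

    f-L : f N L ≡ (N C a) * (blockCount M t * f s l)
    f-L = denom*q≡!⇒f≡q N L _ denom*quotient≡!

tail≤head : ∀ {x l} → NonIncreasing (x ∷ l) → All (_≤ x) l
tail≤head [-]        = []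
tail≤head (y≤x ∷ l↓) = y≤x ∷ All.map (λ v≤y → ≤-trans v≤y y≤x) (tail≤head l↓)

record TopBlockSplit (M : ℕ) (l : List ℕ) : Set where
  constructor split
  field
    t     : ℕ
    rest  : List ℕ
    l≡    : l ≡ replicate t (suc M) ++ rest
    rest↓ : NonIncreasing rest
    rest∈ : All (InRange 1 M) rest

topBlockSplit : ∀ M l → NonIncreasing l → All (InRange 1 (suc M)) l → TopBlockSplit M l
topBlockSplit M []      _  _ = split 0 [] refl [] []
topBlockSplit M (x ∷ l) l↓ ((1≤x , x≤1+M) ∷ l∈) with x ≟ suc M
... | yes refl = let open TopBlockSplit (topBlockSplit M l (Linked.tail l↓) l∈)
                 in split (suc t) rest (cong (suc M ∷_) l≡) rest↓ rest∈
... | no  x≢1+M = split 0 (x ∷ l) refl l↓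
                    ((1≤x , x≤M) ∷ All.zipWith (λ ((1≤v , _) , v≤x) → 1≤v , ≤-trans v≤x x≤M)
                                               (l∈ , tail≤head l↓))
  where
  x≤M : x ≤ M
  x≤M = ≤-pred (≤∧≢⇒< x≤1+M x≢1+M)

f*denom≡! : ∀ M l → NonIncreasing l → All (InRange 1 M) l → f (sum l) l * denom (sum l) l ≡ sum l !
f*denom≡! zero    []      _  _                    = refl
f*denom≡! zero    (x ∷ l) _  ((1≤x , x≤0) ∷ _)    = ⊥-elim (<⇒≱ 1≤x x≤0)
f*denom≡! (suc M) l       l↓ l∈ with topBlockSplit M l l↓ l∈
... | split t rest refl rest↓ rest∈ = subst (λ n → f n L * denom n L ≡ n !) (sym sum-L) (begin
  f N L * denom N L                                   ≡⟨ cong (_* denom N L) (f-L f*denom≡!-rest) ⟩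
  (N C a) * (blockCount M t * f s rest) * denom N L   ≡⟨ *-comm _ (denom N L) ⟩
  denom N L * ((N C a) * (blockCount M t * f s rest)) ≡⟨ denom*quotient≡! f*denom≡!-rest ⟩
  N !                                                 ∎)
  where
  open TopBlock M t rest rest∈
  f*denom≡!-rest : f s rest * denom s rest ≡ s !
  f*denom≡!-rest = f*denom≡! M rest rest↓ rest∈

product-map-replicate : ∀ (x : Seq) t k → product (map x (replicate t k)) ≡ x k ^ t
product-map-replicate x zero    k = refl
product-map-replicate x (suc t) k = cong (x k *_) (product-map-replicate x t k)

partitionWeight : Seq → ℕ → List ℕ → ℕ
partitionWeight x n l = guard (sum l ≟ n) (f n l * product (map x l))

module _ (x : Seq) (M t : ℕ) (l : List ℕ) (l∈ : All (InRange 1 M) l) where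
  open TopBlock M t l l∈

  partitionWeight-topBlock : NonIncreasing l → ∀ n →
    partitionWeight x n L ≡ (x K ^ t * blockCount M t) * ((n C a) * partitionWeight x (n ∸ a) l)
  partitionWeight-topBlock l↓ n with N ≟ n
  ... | yes refl = begin
    guard (sum L ≟ N) (f N L * product (map x L))
      ≡⟨ guard-yes (sum L ≟ N) _ sum-L ⟩
    f N L * product (map x L)
      ≡⟨ cong₂ _*_ (f-L (f*denom≡! M l l↓ l∈)) product-L ⟩
    (N C a) * (blockCount M t * f s l) * (x K ^ t * product (map x l))
      ≡⟨ rearrange (N C a) (blockCount M t) (f s l) (x K ^ t) (product (map x l)) ⟩
    (x K ^ t * blockCount M t) * ((N C a) * (f s l * product (map x l)))
      ≡⟨ cong (λ w → (x K ^ t * blockCount M t) * ((N C a) * w)) (guard-yes (s ≟ s) _ refl) ⟨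
    (x K ^ t * blockCount M t) * ((N C a) * partitionWeight x s l)
      ≡⟨ cong (λ m → (x K ^ t * blockCount M t) * ((N C a) * partitionWeight x m l)) (m+n∸m≡n a s) ⟨
    (x K ^ t * blockCount M t) * ((N C a) * partitionWeight x (N ∸ a) l) ∎
    where
    product-L : product (map x L) ≡ x K ^ t * product (map x l)
    product-L = trans (cong product (map-++ x (replicate t K) l))
                      (trans (product-++ (map x (replicate t K)) (map x l))
                             (cong (_* product (map x l)) (product-map-replicate x t K)))
    rearrange : ∀ c b g p q → c * (b * g) * (p * q) ≡ (p * b) * (c * (g * q))
    rearrange = solve-∀
  ... | no N≢n = begin
    partitionWeight x n L
      ≡⟨ guard-no (sum L ≟ n) _ (N≢n ∘ trans (sym sum-L)) ⟩
    0
      ≡⟨ *-zeroʳ (x K ^ t * blockCount M t) ⟨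
    (x K ^ t * blockCount M t) * 0
      ≡⟨ cong ((x K ^ t * blockCount M t) *_) rest-zero ⟨
    (x K ^ t * blockCount M t) * ((n C a) * partitionWeight x (n ∸ a) l) ∎
    where
    rest-zero : (n C a) * partitionWeight x (n ∸ a) l ≡ 0
    rest-zero with a ≤? n
    ... | yes a≤n = trans (cong ((n C a) *_) (guard-no (s ≟ n ∸ a) _ (λ s≡n∸a →
                            N≢n (trans (cong (a +_) s≡n∸a) (m+[n∸m]≡n a≤n)))))
                          (*-zeroʳ (n C a))
    ... | no  a≰n = cong (_* partitionWeight x (n ∸ a) l) (k>n⇒nCk≡0 (≰⇒> a≰n))

  guarded-partitionWeight-topBlock : ∀ n (d : Dec (NonIncreasing l)) →
    guard d (partitionWeight x n L) ≡ (x K ^ t * blockCount M t) * ((n C a) * guard d (partitionWeight x (n ∸ a) l))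
  guarded-partitionWeight-topBlock n (yes l↓) = partitionWeight-topBlock l↓ n
  guarded-partitionWeight-topBlock n (no _)  =
    sym (trans (cong ((x K ^ t * blockCount M t) *_) (*-zeroʳ (n C a))) (*-zeroʳ (x K ^ t * blockCount M t)))

range-bounds : ∀ lo hi → All (InRange lo hi) (range lo hi)
range-bounds lo hi = applyUpTo⁺₁ (lo +_) (suc hi ∸ lo) (λ {i} i< → m≤m+n lo i , ≤-pred (lo+i≤hi i i<))
  where
  lo+i≤hi : ∀ i → i < suc hi ∸ lo → lo + i < suc hi
  lo+i≤hi i i< with lo ≤? suc hi
  ... | yes lo≤ = subst (lo + i <_) (m+[n∸m]≡n lo≤) (+-monoʳ-< lo i<)
  ... | no  lo≰ = ⊥-elim (n≮0 (subst (i <_) (m≤n⇒m∸n≡0 (<⇒≤ (≰⇒> lo≰))) i<))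

tuples-bounds : ∀ len lo hi → All (All (InRange lo hi)) (tuples len lo hi)
tuples-bounds zero      lo hi = [] ∷ []
tuples-bounds (suc len) lo hi =
  concat⁺ (map⁺ (All.map (λ i∈ → map⁺ (All.map (i∈ ∷_) (tuples-bounds len lo hi))) (range-bounds lo hi)))

ΣNonIncreasing : ℕ → ℕ → (List ℕ → ℕ) → ℕ
ΣNonIncreasing len hi G = sumMap (λ l → guard (linked? _≥?_ l) (G l)) (tuples len 1 hi)

ΣAfter : ℕ → ℕ → ℕ → (List ℕ → ℕ) → ℕ
ΣAfter len hi i H = sumMap (λ l → guard (linked? _≥?_ (i ∷ l)) (H l)) (tuples len 1 hi)

ΣNonIncreasing-suc : ∀ len hi G →
  ΣNonIncreasing (suc len) hi G ≡ Σ< hi (λ j → ΣAfter len hi (suc j) (G ∘ (suc j ∷_)))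
ΣNonIncreasing-suc len hi G = begin
  sumMap (λ l → guard (linked? _≥?_ l) (G l)) (concatMap (λ i → map (i ∷_) (tuples len 1 hi)) (range 1 hi))
    ≡⟨ sumMap-concatMap _ _ (range 1 hi) ⟩
  sumMap (λ i → sumMap (λ l → guard (linked? _≥?_ l) (G l)) (map (i ∷_) (tuples len 1 hi))) (range 1 hi)
    ≡⟨ sumMap-cong (range 1 hi) (λ i → sumMap-map _ (i ∷_) (tuples len 1 hi)) ⟩
  sumMap (λ i → ΣAfter len hi i (G ∘ (i ∷_))) (range 1 hi)
    ≡⟨ sumMap-applyUpTo (λ i → ΣAfter len hi i (G ∘ (i ∷_))) suc hi ⟩
  Σ< hi (λ j → ΣAfter len hi (suc j) (G ∘ (suc j ∷_))) ∎

guard-linked-∷∷ : ∀ i j l v (d : Dec (j ≤ i)) →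
  guard (linked? _≥?_ (i ∷ j ∷ l)) v ≡ guard d (guard (linked? _≥?_ (j ∷ l)) v)
guard-linked-∷∷ i j l v (yes j≤i) =
  guard-⇔ (linked? _≥?_ (i ∷ j ∷ l)) (linked? _≥?_ (j ∷ l)) v Linked.tail (j≤i ∷_)
guard-linked-∷∷ i j l v (no  j≰i) = guard-no (linked? _≥?_ (i ∷ j ∷ l)) v (j≰i ∘ Linked.head)

-- Only the entries ≤ i can follow i in a non-increasing list, so the range [1, hi] may be cut to [1, i].
ΣAfter-restrict : ∀ len i hi H → i ≤ hi → ΣAfter len hi i H ≡ ΣAfter len i i H
ΣAfter-restrict zero      i hi H i≤hi = refl
ΣAfter-restrict (suc len) i hi H i≤hi = trans (ΣAfter-suc hi i≤hi) (sym (ΣAfter-suc i ≤-refl))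
  where
  next : ℕ → ℕ
  next j = guard (j ≤? i) (ΣAfter len j j (H ∘ (j ∷_)))
  ΣAfter-suc : ∀ h → i ≤ h → ΣAfter (suc len) h i H ≡ Σ< i (next ∘ suc)
  ΣAfter-suc h i≤h = begin
    ΣAfter (suc len) h i H
      ≡⟨ sumMap-concatMap _ _ (range 1 h) ⟩
    sumMap (λ j → sumMap (λ l → guard (linked? _≥?_ (i ∷ l)) (H l)) (map (j ∷_) (tuples len 1 h))) (range 1 h)
      ≡⟨ sumMap-cong (range 1 h) (λ j → trans (sumMap-map _ (j ∷_) (tuples len 1 h)) (head-j j (j ≤? i))) ⟩
    sumMap next (range 1 h)
      ≡⟨ sumMap-applyUpTo next suc h ⟩
    Σ< h (next ∘ suc)
      ≡⟨ Σ<-extend (next ∘ suc) i≤h (λ j i≤j → guard-no (suc j ≤? i) _ (λ 1+j≤i → <⇒≱ 1+j≤i i≤j)) ⟩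
    Σ< i (next ∘ suc) ∎
    where
    head-j : ∀ j (d : Dec (j ≤ i)) →
             sumMap (λ l → guard (linked? _≥?_ (i ∷ j ∷ l)) (H (j ∷ l))) (tuples len 1 h) ≡
             guard d (ΣAfter len j j (H ∘ (j ∷_)))
    head-j j d = begin
      sumMap (λ l → guard (linked? _≥?_ (i ∷ j ∷ l)) (H (j ∷ l))) (tuples len 1 h)
        ≡⟨ sumMap-cong (tuples len 1 h) (λ l → guard-linked-∷∷ i j l (H (j ∷ l)) d) ⟩
      sumMap (λ l → guard d (guard (linked? _≥?_ (j ∷ l)) (H (j ∷ l)))) (tuples len 1 h)
        ≡⟨ sumMap-guard d _ (tuples len 1 h) ⟩
      guard d (ΣAfter len h j (H ∘ (j ∷_)))
        ≡⟨ restrict d ⟩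
      guard d (ΣAfter len j j (H ∘ (j ∷_))) ∎
      where
      restrict : ∀ d → guard d (ΣAfter len h j (H ∘ (j ∷_))) ≡ guard d (ΣAfter len j j (H ∘ (j ∷_)))
      restrict (yes j≤i) = ΣAfter-restrict len j h (H ∘ (j ∷_)) (≤-trans j≤i i≤h)
      restrict (no _)    = refl

ΣAfter-self : ∀ len hi H → ΣAfter len hi hi H ≡ ΣNonIncreasing len hi H
ΣAfter-self len hi H = sumMap-congᴬ (tuples-bounds len 1 hi) (λ {l} l∈ →
  guard-⇔ (linked? _≥?_ (hi ∷ l)) (linked? _≥?_ l) (H l) Linked.tail (cons (All.map proj₂ l∈)))
  where
  cons : ∀ {l} → All (_≤ hi) l → NonIncreasing l → NonIncreasing (hi ∷ l)
  cons []          []  = [-]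
  cons (y≤hi ∷ _)  l↓  = y≤hi ∷ l↓

ΣNonIncreasing-top : ∀ len M G → ΣNonIncreasing len (suc M) G ≡
  Σ< (suc len) (λ t → ΣNonIncreasing (len ∸ t) M (G ∘ (replicate t (suc M) ++_)))
ΣNonIncreasing-top zero      M G = refl
ΣNonIncreasing-top (suc len) M G = begin
  ΣNonIncreasing (suc len) (suc M) G
    ≡⟨ ΣNonIncreasing-suc len (suc M) G ⟩
  Σ< M (λ j → ΣAfter len (suc M) (suc j) (G ∘ (suc j ∷_))) + ΣAfter len (suc M) (suc M) (G ∘ (suc M ∷_))
    ≡⟨ cong₂ _+_ (Σ<-cong M (λ j j<M → trans (ΣAfter-restrict len (suc j) (suc M) _ (m≤n⇒m≤1+n j<M))
                                              (sym (ΣAfter-restrict len (suc j) M _ j<M))))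
                 (ΣAfter-self len (suc M) (G ∘ (suc M ∷_))) ⟩
  Σ< M (λ j → ΣAfter len M (suc j) (G ∘ (suc j ∷_))) + ΣNonIncreasing len (suc M) (G ∘ (suc M ∷_))
    ≡⟨ cong₂ _+_ (sym (ΣNonIncreasing-suc len M G)) (ΣNonIncreasing-top len M (G ∘ (suc M ∷_))) ⟩
  ΣNonIncreasing (suc len) M G +
  Σ< (suc len) (λ t → ΣNonIncreasing (len ∸ t) M (G ∘ (suc M ∷_) ∘ (replicate t (suc M) ++_)))
    ≡⟨ Σ<-head (suc len) (λ t → ΣNonIncreasing (suc len ∸ t) M (G ∘ (replicate t (suc M) ++_))) ⟨
  Σ< (suc (suc len)) (λ t → ΣNonIncreasing (suc len ∸ t) M (G ∘ (replicate t (suc M) ++_))) ∎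

-- Partial Bell polynomials as sums over partitions

truncate : Seq → ℕ → Seq
truncate x M p = guard (p ≤? M) (x p)

truncate-suc : ∀ x M p → truncate x (suc M) p ≡ truncate x M p + x (suc M) * basis (suc M) p
truncate-suc x M p with p ≤? M
... | yes p≤M = begin
  guard (p ≤? suc M) (x p)             ≡⟨ guard-yes (p ≤? suc M) (x p) (m≤n⇒m≤1+n p≤M) ⟩
  x p                                  ≡⟨ +-identityʳ (x p) ⟨
  x p + 0                              ≡⟨ cong (x p +_) (*-zeroʳ (x (suc M))) ⟨
  x p + x (suc M) * 0                  ≡⟨ cong (λ e → x p + x (suc M) * e) (basis-other (suc M) p p≢1+M) ⟨
  x p + x (suc M) * basis (suc M) p    ∎
  where
  p≢1+M : p ≢ suc M
  p≢1+M = <⇒≢ (s≤s p≤M)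
... | no  p≰M with p ≟ suc M
...   | yes refl = trans (guard-yes (suc M ≤? suc M) _ ≤-refl)
                         (sym (trans (cong (x (suc M) *_) (basis-same (suc M))) (*-identityʳ _)))
...   | no  p≢1+M = trans (guard-no (p ≤? suc M) _ (λ p≤1+M → p≰M (≤-pred (≤∧≢⇒< p≤1+M p≢1+M))))
                          (sym (trans (cong (x (suc M) *_) (basis-other (suc M) p p≢1+M)) (*-zeroʳ (x (suc M)))))

bell-of-constant : ∀ (a : Seq) r n → (∀ i → a (suc i) ≡ 0) → bell a (suc r) n ≡ 0
bell-of-constant a r zero    _     = refl
bell-of-constant a r (suc n) a′≡0 =
  trans (⊛-comm n (D a) (bell a r)) (⊛-zeroʳ n (bell a r) (D a) (λ i _ → a′≡0 i))

bell-monomial : ∀ c M t j →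
  bell (λ p → c * basis (suc M) p) t j ≡ (c ^ t * blockCount M t) * basis (t * suc M) j
bell-monomial c M zero    j       = sym (*-identityˡ (δ j))
bell-monomial c M (suc t) zero    = sym (*-zeroʳ (c ^ suc t * blockCount M (suc t)))
bell-monomial c M (suc t) (suc j) = begin
  ((λ p → c * basis M p) ⊛ bell (λ p → c * basis (suc M) p) t) j
    ≡⟨ ⊛-congʳ j _ (λ i _ → bell-monomial c M t i) ⟩
  ((λ p → c * basis M p) ⊛ (λ i → (c ^ t * blockCount M t) * basis (t * suc M) i)) j
    ≡⟨ trans (⊛-*ˡ j c (basis M) _) (cong (c *_) (⊛-*ʳ j (c ^ t * blockCount M t) (basis M) _)) ⟩
  c * ((c ^ t * blockCount M t) * (basis M ⊛ basis (t * suc M)) j)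
    ≡⟨ cong (λ e → c * ((c ^ t * blockCount M t) * e)) (basis⊛basis M (t * suc M) j) ⟩
  c * ((c ^ t * blockCount M t) * (((M + t * suc M) C M) * basis (M + t * suc M) j))
    ≡⟨ rearrange c (c ^ t) (blockCount M t) ((M + t * suc M) C M) (basis (M + t * suc M) j) ⟩
  (c ^ suc t * blockCount M (suc t)) * basis (M + t * suc M) j ∎
  where
  rearrange : ∀ c p u b e → c * ((p * u) * (b * e)) ≡ (c * p * (b * u)) * e
  rearrange = solve-∀

-- The binomial theorem (A + B)ʳ/r! = Σₛ A^{r−s}/(r−s)! · Bˢ/s!.
bell-+ : ∀ (a b : Seq) r j → bell (λ p → a p + b p) r j ≡ Σ< (suc r) (λ s → (bell a (r ∸ s) ⊛ bell b s) j)
bell-+ a b zero    j       = sym (⊛-δ j δ)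
bell-+ a b (suc r) zero    = sym (Σ<-zero (suc (suc r)) _ λ
  { zero    _ → refl
  ; (suc s) _ → *-zeroʳ (bell a (suc r ∸ suc s) 0) })
bell-+ a b (suc r) (suc j) = begin
  ((λ p → D a p + D b p) ⊛ bell (λ p → a p + b p) r) j
    ≡⟨ ⊛-congʳ j _ (λ i _ → bell-+ a b r i) ⟩
  ((λ p → D a p + D b p) ⊛ Q) j
    ≡⟨ ⊛-distribʳ-+ j (D a) (D b) Q ⟩
  (D a ⊛ Q) j + (D b ⊛ Q) j
    ≡⟨ cong₂ _+_ differentiate-a differentiate-b ⟨
  Σ< (suc (suc r)) Ta + Σ< (suc (suc r)) Tb
    ≡⟨ Σ<-+ (suc (suc r)) Ta Tb ⟨
  Σ< (suc (suc r)) (λ s → (bell a (suc r ∸ s) ⊛ bell b s) (suc j)) ∎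
  where
  Q Ta Tb : Seq
  Q i  = Σ< (suc r) (λ s → (bell a (r ∸ s) ⊛ bell b s) i)
  Ta s = (D (bell a (suc r ∸ s)) ⊛ bell b s) j
  Tb s = (bell a (suc r ∸ s) ⊛ D (bell b s)) j
  differentiate-a : Σ< (suc (suc r)) Ta ≡ (D a ⊛ Q) j
  differentiate-a = begin
    Σ< (suc r) Ta + Ta (suc r)
      ≡⟨ cong (Σ< (suc r) Ta +_) (trans (cong (λ k → (D (bell a k) ⊛ bell b (suc r)) j) (n∸n≡0 (suc r)))
                                        (trans (⊛-comm j _ (bell b (suc r))) (⊛-zeroʳ j _ _ (λ _ _ → refl)))) ⟩
    Σ< (suc r) Ta + 0
      ≡⟨ +-identityʳ _ ⟩
    Σ< (suc r) Ta
      ≡⟨ Σ<-cong (suc r) (λ s s≤r →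
           trans (cong (λ k → (D (bell a k) ⊛ bell b s) j) (+-∸-assoc 1 (≤-pred s≤r)))
                 (⊛-assoc j (D a) (bell a (r ∸ s)) (bell b s))) ⟩
    Σ< (suc r) (λ s → (D a ⊛ (bell a (r ∸ s) ⊛ bell b s)) j)
      ≡⟨ ⊛-Σ<ʳ j (suc r) (D a) _ ⟨
    (D a ⊛ Q) j ∎
  differentiate-b : Σ< (suc (suc r)) Tb ≡ (D b ⊛ Q) j
  differentiate-b = begin
    Σ< (suc (suc r)) Tb
      ≡⟨ Σ<-head (suc r) Tb ⟩
    Tb 0 + Σ< (suc r) (Tb ∘ suc)
      ≡⟨ cong (_+ Σ< (suc r) (Tb ∘ suc)) (⊛-zeroʳ j _ _ (λ _ _ → refl)) ⟩
    Σ< (suc r) (Tb ∘ suc)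
      ≡⟨ Σ<-cong (suc r) (λ s _ → ⊛-rotate j (bell a (r ∸ s)) (D b) (bell b s)) ⟩
    Σ< (suc r) (λ s → (D b ⊛ (bell a (r ∸ s) ⊛ bell b s)) j)
      ≡⟨ ⊛-Σ<ʳ j (suc r) (D b) _ ⟨
    (D b ⊛ Q) j ∎

bell-truncate-suc : ∀ x M r n → bell (truncate x (suc M)) r n ≡
  Σ< (suc r) (λ t → (x (suc M) ^ t * blockCount M t) * ((n C (t * suc M)) * bell (truncate x M) (r ∸ t) (n ∸ t * suc M)))
bell-truncate-suc x M r n = begin
  bell (truncate x (suc M)) r n
    ≡⟨ bell-cong r n _ _ (λ i _ → truncate-suc x M (suc i)) ⟩
  bell (λ p → truncate x M p + c * basis (suc M) p) r n
    ≡⟨ bell-+ (truncate x M) _ r n ⟩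
  Σ< (suc r) (λ t → (bell (truncate x M) (r ∸ t) ⊛ bell (λ p → c * basis (suc M) p) t) n)
    ≡⟨ Σ<-cong (suc r) (λ t _ → term t) ⟩
  Σ< (suc r) (λ t → (c ^ t * blockCount M t) * ((n C (t * suc M)) * bell (truncate x M) (r ∸ t) (n ∸ t * suc M))) ∎
  where
  c : ℕ
  c = x (suc M)
  term : ∀ t → (bell (truncate x M) (r ∸ t) ⊛ bell (λ p → c * basis (suc M) p) t) n ≡
               (c ^ t * blockCount M t) * ((n C (t * suc M)) * bell (truncate x M) (r ∸ t) (n ∸ t * suc M))
  term t = begin
    (bell (truncate x M) (r ∸ t) ⊛ bell (λ p → c * basis (suc M) p) t) n
      ≡⟨ ⊛-congʳ n _ (λ i _ → bell-monomial c M t i) ⟩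
    (bell (truncate x M) (r ∸ t) ⊛ (λ i → (c ^ t * blockCount M t) * basis (t * suc M) i)) n
      ≡⟨ ⊛-*ʳ n (c ^ t * blockCount M t) _ (basis (t * suc M)) ⟩
    (c ^ t * blockCount M t) * (bell (truncate x M) (r ∸ t) ⊛ basis (t * suc M)) n
      ≡⟨ cong ((c ^ t * blockCount M t) *_) (⊛-basis n (t * suc M) _) ⟩
    (c ^ t * blockCount M t) * ((n C (t * suc M)) * bell (truncate x M) (r ∸ t) (n ∸ t * suc M)) ∎

ΣNonIncreasing≡bell-truncate : ∀ x M r n → ΣNonIncreasing r M (partitionWeight x n) ≡ bell (truncate x M) r n
ΣNonIncreasing≡bell-truncate x zero    zero    zero    = refl
ΣNonIncreasing≡bell-truncate x zero    zero    (suc n) = refl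
ΣNonIncreasing≡bell-truncate x zero    (suc r) n       = sym (bell-of-constant (truncate x 0) r n (λ _ → refl))
ΣNonIncreasing≡bell-truncate x (suc M) r       n       = begin
  ΣNonIncreasing r (suc M) (partitionWeight x n)
    ≡⟨ ΣNonIncreasing-top r M (partitionWeight x n) ⟩
  Σ< (suc r) (λ t → ΣNonIncreasing (r ∸ t) M (partitionWeight x n ∘ (replicate t (suc M) ++_)))
    ≡⟨ Σ<-cong (suc r) (λ t _ → term t) ⟩
  Σ< (suc r) (λ t → (c ^ t * blockCount M t) * ((n C (t * suc M)) * bell (truncate x M) (r ∸ t) (n ∸ t * suc M)))
    ≡⟨ bell-truncate-suc x M r n ⟨
  bell (truncate x (suc M)) r n ∎
  where
  c : ℕ
  c = x (suc M)
  term : ∀ t → ΣNonIncreasing (r ∸ t) M (partitionWeight x n ∘ (replicate t (suc M) ++_)) ≡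
               (c ^ t * blockCount M t) * ((n C (t * suc M)) * bell (truncate x M) (r ∸ t) (n ∸ t * suc M))
  term t = begin
    ΣNonIncreasing (r ∸ t) M (partitionWeight x n ∘ (replicate t (suc M) ++_))
      ≡⟨ sumMap-congᴬ (tuples-bounds (r ∸ t) 1 M)
           (λ {l} l∈ → guarded-partitionWeight-topBlock x M t l l∈ n (linked? _≥?_ l)) ⟩
    sumMap (λ l → w * (b * g l)) (tuples (r ∸ t) 1 M)
      ≡⟨ sumMap-*ˡ w (λ l → b * g l) (tuples (r ∸ t) 1 M) ⟩
    w * sumMap (λ l → b * g l) (tuples (r ∸ t) 1 M)
      ≡⟨ cong (w *_) (sumMap-*ˡ b g (tuples (r ∸ t) 1 M)) ⟩
    w * (b * ΣNonIncreasing (r ∸ t) M (partitionWeight x (n ∸ t * suc M)))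
      ≡⟨ cong (λ e → w * (b * e)) (ΣNonIncreasing≡bell-truncate x M (r ∸ t) (n ∸ t * suc M)) ⟩
    w * (b * bell (truncate x M) (r ∸ t) (n ∸ t * suc M)) ∎
    where
    w b : ℕ
    w = c ^ t * blockCount M t
    b = n C (t * suc M)
    g : List ℕ → ℕ
    g l = guard (linked? _≥?_ l) (partitionWeight x (n ∸ t * suc M) l)

Σpartitions≡bell : ∀ x n r → sumMap (λ p → f n p * product (map x p)) (partitionsOfLength n r) ≡ bell x r n
Σpartitions≡bell x n r = begin
  sumMap (λ p → f n p * product (map x p)) (partitionsOfLength n r)
    ≡⟨ sumMap-filter-guard (λ p → linked? _≥?_ p ×-dec (sum p ≟ n)) _ (tuples r 1 n) ⟩
  sumMap (λ p → guard (linked? _≥?_ p ×-dec (sum p ≟ n)) (f n p * product (map x p))) (tuples r 1 n)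
    ≡⟨ sumMap-cong (tuples r 1 n) (λ p → guard-×-dec (linked? _≥?_ p) (sum p ≟ n) _) ⟩
  ΣNonIncreasing r n (partitionWeight x n)
    ≡⟨ ΣNonIncreasing≡bell-truncate x n r n ⟩
  bell (truncate x n) r n
    ≡⟨ bell-cong r n _ _ (λ i i<n → guard-yes (suc i ≤? n) (x (suc i)) i<n) ⟩
  bell x r n ∎

mainTheorem9 : (n k r : ℕ) → 2 ≤ k → 1 ≤ r → r ≤ n → T n k r ≡ rhs n k r
mainTheorem9 n (suc zero)    r (s≤s ()) _ _
mainTheorem9 n (suc (suc k)) r _ _ _ = begin
  T n (suc (suc k)) r      ≡⟨ T≡chainSum n (suc k) r ⟩
  chainSum (suc k) n r     ≡⟨ chainSum≡bell (suc k) n r ⟩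
  bell (chainTotal k) r n  ≡⟨ bell-cong r n _ _ (λ p _ → chainTotal≡Σ<T p) ⟩
  bell x r n               ≡⟨ Σpartitions≡bell x n r ⟨
  rhs n (suc (suc k)) r    ∎
  where
  x : Seq
  x p = sum (map (T p (suc k)) (range 1 p))
  chainTotal≡Σ<T : ∀ p → chainTotal k (suc p) ≡ x (suc p)
  chainTotal≡Σ<T p = begin
    Σ< (suc (suc p)) (chainSum k (suc p))
      ≡⟨ Σ<-head (suc p) _ ⟩
    chainSum k (suc p) 0 + Σ< (suc p) (chainSum k (suc p) ∘ suc)
      ≡⟨ cong (_+ Σ< (suc p) (chainSum k (suc p) ∘ suc)) (chainSum≡bell k (suc p) 0) ⟩
    Σ< (suc p) (chainSum k (suc p) ∘ suc)
      ≡⟨ Σ<-cong (suc p) (λ j _ → T≡chainSum (suc p) k (suc j)) ⟨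
    Σ< (suc p) (T (suc p) (suc k) ∘ suc)
      ≡⟨ sumMap-applyUpTo (T (suc p) (suc k)) suc (suc p) ⟨
    x (suc p) ∎
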